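{- For every odd integer $k \ge 1$, every outer $k$-planar drawing of a maximal outer $k$-planar graph admits a triangulation of the outer cycle with edge piercing number at most $k$ and triangle piercing number at most $3k-1$.
   Context: A convex drawing of a finite simple graph $G$ places the vertices at distinct points of a circle and draws every edge as a straight-line segment; it is outer $k$-planar if every edge crosses at most $k$ other edges. $G$ is outer $k$-planar if it has such a drawing, and maximal outer $k$-planar if it is outer $k$-planar and adding any non-adjacent vertex pair as an edge yields a graph that is not outer $k$-planar. Given a convex drawing with counterclockwise cyclic vertex order $v_1,\dots,v_n$, two pairs of four distinct vertices are intertwined if their vertices alternate in the cyclic order. The outer cycle is the cycle $v_1v_2\cdots v_nv_1$ (regardless of whether these pairs are edges of $G$). A triangulation of the outer cycle is a set of vertex pairs, called links, consisting of the $n$ outer links $\{v_t,v_{t+1}\}$ (indices mod $n$) together with $n-3$ pairwise non-intertwined pairs of non-consecutive vertices (inner links), so that the links form a triangulated $n$-gon, whose triangular faces are the triangles of the triangulation. A link is pierced by an edge of $G$ if the link and the edge are intertwined; the piercing number of a link is the number of edges of $G$ piercing it; the edge piercing number of the triangulation is the maximum piercing number over its links. The piercing number of a triangle is the sum of the piercing numbers of its three sides, and the triangle piercing number of the triangulation is the maximum piercing number over its triangles. -}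

module Defs where

open import Data.Bool using (Bool; true; false; _∧_; _∨_; if_then_else_)
open import Data.Nat using (ℕ; zero; suc; _+_; _*_; _∸_; _≤_; _<_; _<ᵇ_; _≡ᵇ_)
open import Data.Fin using (Fin; toℕ)
open import Data.Fin.Permutation using (Permutation′; _⟨$⟩ʳ_)
open import Data.List using (List; length; allFin; map)
open import Data.Nat.ListAction using (sum)
open import Data.List.Membership.Propositional using (_∈_)
open import Data.List.Relation.Unary.All using (All)
open import Data.List.Relation.Unary.AllPairs using (AllPairs)
open import Data.Product using (_×_; _,_)
open import Data.Sum using (_⊎_)
open import Relation.Binary.PropositionalEquality using (_≡_; _≢_)
open import Relation.Nullary using (¬_)

record Graph (n : ℕ) : Set where
  field
    adj   : Fin n → Fin n → Bool
    sym   : ∀ u v → adj u v ≡ adj v u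
    irrefl : ∀ u → adj u u ≡ false
open Graph public

_==_ : ∀ {n} → Fin n → Fin n → Bool
u == v = toℕ u ≡ᵇ toℕ v

addEdgeAdj : ∀ {n} → Graph n → Fin n → Fin n → Fin n → Fin n → Bool
addEdgeAdj G u v x y = adj G x y ∨ ((x == u ∧ y == v) ∨ (x == v ∧ y == u))

-- Positions are 0,…,n-1 in counterclockwise order.  The pairs {a,b} and
-- {c,d} are intertwined iff exactly one of c,d lies strictly inside the
-- arc (min a b, max a b) and the other strictly outside [min a b, max a b]
-- (this forces all four to be distinct and to alternate cyclically).

inside : ℕ → ℕ → ℕ → Bool
inside a b x = ((a <ᵇ x) ∧ (x <ᵇ b)) ∨ ((b <ᵇ x) ∧ (x <ᵇ a))

outside : ℕ → ℕ → ℕ → Bool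
outside a b x = ((x <ᵇ a) ∧ (x <ᵇ b)) ∨ ((a <ᵇ x) ∧ (b <ᵇ x))

intertwinedℕ : ℕ → ℕ → ℕ → ℕ → Bool
intertwinedℕ a b c d =
  (inside a b c ∧ outside a b d) ∨ (outside a b c ∧ inside a b d)

intertwined : ∀ {n} → Fin n → Fin n → Fin n → Fin n → Bool
intertwined a b c d = intertwinedℕ (toℕ a) (toℕ b) (toℕ c) (toℕ d)

-- Convex drawings: a convex drawing of G is determined (for crossing
-- purposes) by the cyclic order of its vertices; we represent it by a
-- permutation π sending each vertex to its position 0,…,n-1 in the
-- counterclockwise order.

pos : ∀ {n} → Permutation′ n → Fin n → Fin n
pos π v = π ⟨$⟩ʳ v

countPierce : ∀ {n} → (Fin n → Fin n → Bool) → Permutation′ n → Fin n → Fin n → ℕ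
countPierce {n} A π p q =
  sum (map (λ x → sum (map (λ y →
        if (toℕ x <ᵇ toℕ y) ∧ (A x y ∧ intertwined p q (pos π x) (pos π y))
        then 1 else 0) (allFin n))) (allFin n))

crossings : ∀ {n} → (Fin n → Fin n → Bool) → Permutation′ n → Fin n → Fin n → ℕ
crossings A π u v = countPierce A π (pos π u) (pos π v)

OuterKPlanarDrawingAdj : ∀ {n} → ℕ → (Fin n → Fin n → Bool) → Permutation′ n → Set
OuterKPlanarDrawingAdj k A π = ∀ u v → A u v ≡ true → crossings A π u v ≤ k

OuterKPlanarDrawing : ∀ {n} → ℕ → Graph n → Permutation′ n → Set
OuterKPlanarDrawing k G π = OuterKPlanarDrawingAdj k (adj G) π

OuterKPlanarAdj : ∀ {n} → ℕ → (Fin n → Fin n → Bool) → Set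
OuterKPlanarAdj {n} k A = Data.Product.Σ (Permutation′ n) (OuterKPlanarDrawingAdj k A)

MaximalOuterKPlanar : ∀ {n} → ℕ → Graph n → Set
MaximalOuterKPlanar k G =
  OuterKPlanarAdj k (adj G) ×
  (∀ u v → u ≢ v → adj G u v ≡ false → ¬ OuterKPlanarAdj k (addEdgeAdj G u v))

OuterLink : ∀ {n} → Fin n → Fin n → Set
OuterLink {n} p q =
  (toℕ q ≡ suc (toℕ p)) ⊎ (toℕ p ≡ suc (toℕ q)) ⊎
  ((toℕ p ≡ 0 × suc (toℕ q) ≡ n) ⊎ (toℕ q ≡ 0 × suc (toℕ p) ≡ n))

-- An inner link is stored as an ordered pair (i , j) with i < j.
InnerLinkOK : ∀ {n} → Fin n × Fin n → Set
InnerLinkOK (i , j) = (toℕ i < toℕ j) × ¬ OuterLink i j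

NonIntertwinedDistinct : ∀ {n} → Fin n × Fin n → Fin n × Fin n → Set
NonIntertwinedDistinct (a , b) (c , d) =
  ((a , b) ≢ (c , d)) × (intertwined a b c d ≡ false)

record Triangulation (n : ℕ) : Set where
  field
    inner        : List (Fin n × Fin n)
    innerCount   : length inner ≡ n ∸ 3
    innerOK      : All InnerLinkOK inner
    nonCrossing  : AllPairs NonIntertwinedDistinct inner
open Triangulation public

IsLink : ∀ {n} → Triangulation n → Fin n → Fin n → Set
IsLink T p q = OuterLink p q ⊎ ((p , q) ∈ inner T) ⊎ ((q , p) ∈ inner T)

piercing : ∀ {n} → Graph n → Permutation′ n → Fin n → Fin n → ℕ
piercing G π p q = countPierce (adj G) π p q

EdgePiercingAtMost : ∀ {n} → Graph n → Permutation′ n → Triangulation n → ℕ → Set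
EdgePiercingAtMost G π T m = ∀ p q → IsLink T p q → piercing G π p q ≤ m

-- Triangles of T: triples of positions a < b < c that are pairwise linked
-- (in a triangulated polygon these are exactly the triangular faces).
TrianglePiercingAtMost : ∀ {n} → Graph n → Permutation′ n → Triangulation n → ℕ → Set
TrianglePiercingAtMost G π T m =
  ∀ a b c → toℕ a < toℕ b → toℕ b < toℕ c →
  IsLink T a b → IsLink T b c → IsLink T a c →
  piercing G π a b + piercing G π b c + piercing G π a c ≤ m

-- Write pierce a b for the number of edges whose endpoint positions are
-- intertwined with the positions a < b.  Nothing pierces (0, n - 1).  A polygon
-- i, i + 1, …, j with pierce i j ≤ k is triangulated by choosing an apex s with
-- pierce i s ≤ k, pierce s j ≤ k and pierce i s + pierce s j ≤ 2k - 1, and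
-- recursing on both halves: then every link is pierced at most k times and every
-- triangle at most 3k - 1 times.
--
-- If no such apex existed, start from the maximal arc (edge or outer link) inside
-- the polygon that leaves i, and replace the current maximal arc (x, y) by the
-- maximal arc (u, v) leaving (x, y] at its leftmost point.  Three inequalities
-- between piercing numbers of four positions (a Monge-type quadrangle inequality,
-- a nesting and a splitting inequality) show that pierce s j > k at the left ends
-- s of these arcs, so v < j and pierce i v < k, and the right ends increase
-- forever.  The three inequalities hold edge by edge, which after an
-- order-preserving relabelling of the positions is a finite check.

module Submission where

open import Defs hiding (sym)
open import Data.Bool using (Bool; true; false; _∧_; _∨_; not; T; if_then_else_)
open import Data.Bool.Properties using (∧-zeroʳ; ∨-comm; ∧-comm; T?; T-≡; ¬-not) renaming (_≟_ to _≟ᵇ_)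
open import Data.Empty using (⊥; ⊥-elim)
open import Data.Fin using (Fin; toℕ; fromℕ<)
open import Data.Fin.Properties using (toℕ<n; toℕ-fromℕ<; toℕ-injective; all?; any?)
open import Data.Fin.Permutation using (Permutation′)
open import Data.List using (List; []; _∷_; _++_; map; length; allFin)
open import Data.List.Properties using (length-++; map-cong)
open import Data.List.Membership.Propositional using (_∈_)
open import Data.List.Membership.Propositional.Properties using (∈-allFin; ∈-++⁻)
open import Data.List.Relation.Unary.All as All using (All; []; _∷_)
import Data.List.Relation.Unary.All.Properties as All
open import Data.List.Relation.Unary.AllPairs using (AllPairs; []; _∷_)
import Data.List.Relation.Unary.AllPairs.Properties as AllPairs
open import Data.List.Relation.Unary.Any using (here; there)
open import Data.Nat
  using (ℕ; zero; suc; _+_; _*_; _∸_; _≤_; _<_; _<ᵇ_; _≤ᵇ_; _≡ᵇ_; s≤s; z≤n; s≤s⁻¹; _≤?_; _<?_; _≟_)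
open import Data.Nat.ListAction using (sum)
open import Data.Nat.Properties
open import Algebra.Properties.CommutativeSemigroup +-commutativeSemigroup using (interchange)
open import Data.Product using (Σ; ∃; ∃₂; _×_; _,_; proj₁; proj₂)
open import Data.Sum using (_⊎_; inj₁; inj₂; [_,_]′; swap)
open import Data.Unit using (tt)
open import Function.Bundles using (Equivalence)
open import Relation.Binary.Definitions using (tri<; tri≈; tri>)
open import Relation.Binary.PropositionalEquality
open import Relation.Nullary using (¬_; Dec; yes; no)
open import Relation.Nullary.Decidable using (toWitness; _×-dec_; _⊎-dec_; ¬?)
open import Relation.Unary using (Decidable)

indicator : Bool → ℕ
indicator b = if b then 1 else 0

indicator≤1 : ∀ b → indicator b ≤ 1
indicator≤1 true  = ≤-refl
indicator≤1 false = z≤n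

indicator-mono : ∀ {b c} → (b ≡ true → c ≡ true) → indicator b ≤ indicator c
indicator-mono {false} _   = z≤n
indicator-mono {true}  b⇒c rewrite b⇒c refl = ≤-refl

T⇒≡true : ∀ {b} → T b → b ≡ true
T⇒≡true = Equivalence.to T-≡

≡true⇒T : ∀ {b} → b ≡ true → T b
≡true⇒T = Equivalence.from T-≡

∧-true⁻ : ∀ {a b} → (a ∧ b) ≡ true → a ≡ true × b ≡ true
∧-true⁻ {true} b≡true = refl , b≡true

not-true⁻ : ∀ {b} → not b ≡ true → b ≡ false
not-true⁻ {false} _ = refl

third-of-∨ : ∀ {a b c} → (a ∨ b ∨ c) ≡ true → a ≡ false → b ≡ false → c ≡ true
third-of-∨ {false} {false} c≡true _ _ = c≡true

≤ᵇ≡true⇒≤ : ∀ {m n} → (m ≤ᵇ n) ≡ true → m ≤ n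
≤ᵇ≡true⇒≤ {m} {n} eq = ≤ᵇ⇒≤ m n (≡true⇒T eq)

<⇒<ᵇ≡true : ∀ {m n} → m < n → (m <ᵇ n) ≡ true
<⇒<ᵇ≡true m<n = T⇒≡true (<⇒<ᵇ m<n)

≥⇒<ᵇ≡false : ∀ {m n} → n ≤ m → (m <ᵇ n) ≡ false
≥⇒<ᵇ≡false {m} {n} n≤m = ¬-not λ m<ᵇn → <⇒≱ (<ᵇ⇒< m n (≡true⇒T m<ᵇn)) n≤m

<ᵇ≡true⇒< : ∀ {m n} → (m <ᵇ n) ≡ true → m < n
<ᵇ≡true⇒< {m} {n} eq = <ᵇ⇒< m n (≡true⇒T eq)

<ᵇ≡false⇒≥ : ∀ {m n} → (m <ᵇ n) ≡ false → n ≤ m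
<ᵇ≡false⇒≥ eq = ≮⇒≥ λ m<n → subst T eq (<⇒<ᵇ m<n)

≡⇒≡ᵇ≡true : ∀ {m n} → m ≡ n → (m ≡ᵇ n) ≡ true
≡⇒≡ᵇ≡true {m} {n} m≡n = T⇒≡true (≡⇒≡ᵇ m n m≡n)

≢⇒≡ᵇ≡false : ∀ {m n} → m ≢ n → (m ≡ᵇ n) ≡ false
≢⇒≡ᵇ≡false {m} {n} m≢n = ¬-not λ m≡ᵇn → m≢n (≡ᵇ⇒≡ m n (≡true⇒T m≡ᵇn))

module _ {A : Set} where

  sum-map-mono : ∀ (xs : List A) {f g : A → ℕ} → (∀ x → f x ≤ g x) → sum (map f xs) ≤ sum (map g xs)
  sum-map-mono []       f≤g = z≤n
  sum-map-mono (x ∷ xs) f≤g = +-mono-≤ (f≤g x) (sum-map-mono xs f≤g)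

  sum-map-+ : ∀ (xs : List A) (f g : A → ℕ) →
    sum (map (λ x → f x + g x) xs) ≡ sum (map f xs) + sum (map g xs)
  sum-map-+ []       f g = refl
  sum-map-+ (x ∷ xs) f g = trans (cong (f x + g x +_) (sum-map-+ xs f g)) (interchange (f x) (g x) _ _)

  sum-map-≡0 : ∀ (xs : List A) {f : A → ℕ} → (∀ x → f x ≡ 0) → sum (map f xs) ≡ 0
  sum-map-≡0 []       f≡0 = refl
  sum-map-≡0 (x ∷ xs) f≡0 = cong₂ _+_ (f≡0 x) (sum-map-≡0 xs f≡0)

  ≤-sum-map : ∀ {xs : List A} (f : A → ℕ) {x} → x ∈ xs → f x ≤ sum (map f xs)
  ≤-sum-map {y ∷ xs} f (here refl)  = m≤m+n (f y) _
  ≤-sum-map {y ∷ xs} f (there x∈xs) = ≤-trans (≤-sum-map f x∈xs) (m≤n+m _ (f y))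

cancel-quadrangle : ∀ {a b c d e} → a + c + e ≤ d + b → d < c + e → a < b
cancel-quadrangle {a} {b} {c} {d} {e} quad d<c+e = +-cancelʳ-< (c + e) a b (begin-strict
  a + (c + e) ≡⟨ +-assoc a c e ⟨
  a + c + e   ≤⟨ quad ⟩
  d + b       <⟨ +-monoˡ-< b d<c+e ⟩
  c + e + b   ≡⟨ +-comm (c + e) b ⟩
  b + (c + e) ∎)
  where open ≤-Reasoning

triangle-bound : ∀ {k a b d} → suc (a + b) ≤ 2 * k → d ≤ k → a + b + d ≤ 3 * k ∸ 1
triangle-bound {k} {a} {b} {d} ab<2k d≤k =
  subst (λ m → a + b + d ≤ m ∸ 1) (+-comm (2 * k) k) (∸-monoˡ-≤ 1 (+-mono-≤ ab<2k d≤k))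

∸-split : ∀ {i s j} → i ≤ s → s ≤ j → j ∸ i ≡ (s ∸ i) + (j ∸ s)
∸-split {i} {s} {j} i≤s s≤j =
  trans (cong (_∸ i) (sym (m∸n+n≡m s≤j))) (trans (+-∸-assoc (j ∸ s) i≤s) (+-comm (j ∸ s) (s ∸ i)))

pred+pred : ∀ {m n} → 1 ≤ m → 1 ≤ n → (m ∸ 1) + (n ∸ 1) ≡ (m + n) ∸ 2
pred+pred {suc m} {suc n} _ _ = sym (cong (_∸ 1) (+-suc m n))

suc[m∸2]≡m∸1 : ∀ {m} → 2 ≤ m → suc (m ∸ 2) ≡ m ∸ 1
suc[m∸2]≡m∸1 {suc zero}    (s≤s ())
suc[m∸2]≡m∸1 {suc (suc m)} _ = refl

∸-positive : ∀ {m n} → m < n → 1 ≤ n ∸ m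
∸-positive {m} {n} m<n = subst (_≤ n ∸ m) (m+n∸n≡m 1 m) (∸-monoˡ-≤ m m<n)

private
  outside-false : ∀ {a b x} → a ≤ x → x ≤ b → outside a b x ≡ false
  outside-false {a} {b} {x} a≤x x≤b rewrite ≥⇒<ᵇ≡false {x} {a} a≤x | ≥⇒<ᵇ≡false {b} {x} x≤b =
    ∧-zeroʳ (a <ᵇ x)

  inside-false-above : ∀ {a b x} → a < b → b ≤ x → inside a b x ≡ false
  inside-false-above {a} {b} {x} a<b b≤x
    rewrite ≥⇒<ᵇ≡false {x} {b} b≤x | ≥⇒<ᵇ≡false {x} {a} (≤-trans (<⇒≤ a<b) b≤x) | ∧-zeroʳ (a <ᵇ x) =
    ∧-zeroʳ (b <ᵇ x)

  inside-false-succ : ∀ p x → inside p (suc p) x ≡ false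
  inside-false-succ p x with <-cmp p x
  ... | tri< p<x _ _ rewrite ≥⇒<ᵇ≡false {x} {suc p} p<x | ≥⇒<ᵇ≡false {x} {p} (<⇒≤ p<x) | ∧-zeroʳ (p <ᵇ x) =
    ∧-zeroʳ (suc p <ᵇ x)
  ... | tri≈ _ refl _ rewrite ≥⇒<ᵇ≡false {p} {p} ≤-refl | ≥⇒<ᵇ≡false {suc p} {p} (n≤1+n p) = refl
  ... | tri> _ _ x<p
    rewrite ≥⇒<ᵇ≡false {p} {x} (<⇒≤ x<p) | ≥⇒<ᵇ≡false {suc p} {x} (≤-trans (n≤1+n x) (≤-trans x<p (n≤1+n p))) =
    refl

  intertwined-false-inside : ∀ {a b c d} → inside a b c ≡ false → inside a b d ≡ false →
    intertwinedℕ a b c d ≡ false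
  intertwined-false-inside {a} {b} {c} {d} c∉ d∉ rewrite c∉ | d∉ = ∧-zeroʳ (outside a b c)

  intertwined-false-outside : ∀ {a b c d} → outside a b c ≡ false → outside a b d ≡ false →
    intertwinedℕ a b c d ≡ false
  intertwined-false-outside {a} {b} {c} c∉ d∉ rewrite c∉ | d∉ | ∧-zeroʳ (inside a b c) = refl

intertwined-succ : ∀ p c d → intertwinedℕ p (suc p) c d ≡ false
intertwined-succ p c d = intertwined-false-inside {p} {suc p} {c} {d} (inside-false-succ p c) (inside-false-succ p d)

intertwined-nested : ∀ {a b c d} → a ≤ c → c ≤ b → a ≤ d → d ≤ b → intertwinedℕ a b c d ≡ false
intertwined-nested {a} {b} {c} {d} a≤c c≤b a≤d d≤b =
  intertwined-false-outside {a} {b} {c} {d} (outside-false a≤c c≤b) (outside-false a≤d d≤b)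

intertwined-disjoint : ∀ {a b c d} → a < b → b ≤ c → b ≤ d → intertwinedℕ a b c d ≡ false
intertwined-disjoint {a} {b} {c} {d} a<b b≤c b≤d =
  intertwined-false-inside {a} {b} {c} {d} (inside-false-above a<b b≤c) (inside-false-above a<b b≤d)

intertwined-sym : ∀ a b c d → intertwinedℕ a b c d ≡ intertwinedℕ b a c d
intertwined-sym a b c d =
  cong₂ _∨_ (cong₂ _∧_ (inside-sym c) (outside-sym d)) (cong₂ _∧_ (outside-sym c) (inside-sym d))
  where
  inside-sym : ∀ x → inside a b x ≡ inside b a x
  inside-sym x = ∨-comm ((a <ᵇ x) ∧ (x <ᵇ b)) ((b <ᵇ x) ∧ (x <ᵇ a))
  outside-sym : ∀ x → outside a b x ≡ outside b a x
  outside-sym x = cong₂ _∨_ (∧-comm (x <ᵇ a) (x <ᵇ b)) (∧-comm (a <ᵇ x) (b <ᵇ x))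

-- Relabelling points on a line

-- rank ts is monotone, keeps every comparison with a member of ts and sends the
-- r-th smallest of distinct ts to 2r + 1, so that configurations of chords
-- relative to ts reduce to finitely many ones.
rankStep : ℕ → ℕ → ℕ
rankStep t x = indicator (t <ᵇ x) + indicator (not (x <ᵇ t))

rank : List ℕ → ℕ → ℕ
rank ts x = sum (map (λ t → rankStep t x) ts)

rankStep-mono : ∀ t {x y} → x ≤ y → rankStep t x ≤ rankStep t y
rankStep-mono t {x} {y} x≤y = +-mono-≤ (indicator-mono above) (indicator-mono notBelow)
  where
  above : (t <ᵇ x) ≡ true → (t <ᵇ y) ≡ true
  above t<x = <⇒<ᵇ≡true (<-≤-trans (<ᵇ≡true⇒< t<x) x≤y)
  notBelow : not (x <ᵇ t) ≡ true → not (y <ᵇ t) ≡ true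
  notBelow x≮t rewrite ≥⇒<ᵇ≡false {y} {t} (≤-trans (<ᵇ≡false⇒≥ (not-true⁻ x≮t)) x≤y) = refl

rank-mono : ∀ ts {x y} → x ≤ y → rank ts x ≤ rank ts y
rank-mono []       _   = z≤n
rank-mono (t ∷ ts) x≤y = +-mono-≤ (rankStep-mono t x≤y) (rank-mono ts x≤y)

rankStep-< : ∀ {t x} → t < x → rankStep t x ≡ 2
rankStep-< {t} {x} t<x rewrite <⇒<ᵇ≡true t<x | ≥⇒<ᵇ≡false {x} {t} (<⇒≤ t<x) = refl

rankStep-≡ : ∀ t → rankStep t t ≡ 1
rankStep-≡ t rewrite ≥⇒<ᵇ≡false {t} {t} ≤-refl = refl

rankStep-> : ∀ {t x} → x < t → rankStep t x ≡ 0
rankStep-> {t} {x} x<t rewrite <⇒<ᵇ≡true x<t | ≥⇒<ᵇ≡false {t} {x} (<⇒≤ x<t) = refl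

rankStep≤2 : ∀ t x → rankStep t x ≤ 2
rankStep≤2 t x = +-mono-≤ (indicator≤1 (t <ᵇ x)) (indicator≤1 (not (x <ᵇ t)))

rank-bound : ∀ ts x → rank ts x ≤ 2 * length ts
rank-bound []       x = z≤n
rank-bound (t ∷ ts) x = ≤-trans (+-mono-≤ (rankStep≤2 t x) (rank-bound ts x))
  (≤-reflexive (sym (*-distribˡ-+ 2 1 (length ts))))

rankStep-strict : ∀ {t a b} → t ≡ a ⊎ t ≡ b → a < b → rankStep t a < rankStep t b
rankStep-strict {a = a} (inj₁ refl) a<b rewrite rankStep-≡ a | rankStep-< a<b = ≤-refl
rankStep-strict {b = b} (inj₂ refl) a<b rewrite rankStep-≡ b | rankStep-> a<b = ≤-refl

rank-strict : ∀ ts {a b} → a ∈ ts ⊎ b ∈ ts → a < b → rank ts a < rank ts b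
rank-strict (t ∷ ts) (inj₁ (here t≡a)) a<b =
  +-mono-<-≤ (rankStep-strict (inj₁ (sym t≡a)) a<b) (rank-mono ts (<⇒≤ a<b))
rank-strict (t ∷ ts) (inj₂ (here t≡b)) a<b =
  +-mono-<-≤ (rankStep-strict (inj₂ (sym t≡b)) a<b) (rank-mono ts (<⇒≤ a<b))
rank-strict (t ∷ ts) (inj₁ (there a∈ts)) a<b =
  +-mono-≤-< (rankStep-mono t (<⇒≤ a<b)) (rank-strict ts (inj₁ a∈ts) a<b)
rank-strict (t ∷ ts) (inj₂ (there b∈ts)) a<b =
  +-mono-≤-< (rankStep-mono t (<⇒≤ a<b)) (rank-strict ts (inj₂ b∈ts) a<b)

rank-<ᵇ : ∀ ts {a b} → a ∈ ts ⊎ b ∈ ts → (a <ᵇ b) ≡ (rank ts a <ᵇ rank ts b)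
rank-<ᵇ ts {a} {b} a∨b∈ts with <-cmp a b
... | tri< a<b _ _ = trans (<⇒<ᵇ≡true a<b) (sym (<⇒<ᵇ≡true (rank-strict ts a∨b∈ts a<b)))
... | tri≈ _ refl _ = trans (≥⇒<ᵇ≡false {a} ≤-refl) (sym (≥⇒<ᵇ≡false {rank ts a} ≤-refl))
... | tri> _ _ b<a =
  trans (≥⇒<ᵇ≡false (<⇒≤ b<a)) (sym (≥⇒<ᵇ≡false (<⇒≤ (rank-strict ts (swap a∨b∈ts) b<a))))

rank-≡ᵇ : ∀ ts {a b} → a ∈ ts ⊎ b ∈ ts → (a ≡ᵇ b) ≡ (rank ts a ≡ᵇ rank ts b)
rank-≡ᵇ ts {a} {b} a∨b∈ts with <-cmp a b
... | tri< a<b _ _ =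
  trans (≢⇒≡ᵇ≡false (<⇒≢ a<b)) (sym (≢⇒≡ᵇ≡false (<⇒≢ (rank-strict ts a∨b∈ts a<b))))
... | tri≈ _ refl _ = trans (≡⇒≡ᵇ≡true {a} refl) (sym (≡⇒≡ᵇ≡true {rank ts a} refl))
... | tri> _ _ b<a =
  trans (≢⇒≡ᵇ≡false (≢-sym (<⇒≢ b<a)))
        (sym (≢⇒≡ᵇ≡false (≢-sym (<⇒≢ (rank-strict ts (swap a∨b∈ts) b<a)))))

module _ (ts : List ℕ) {a b : ℕ} (a∈ts : a ∈ ts) (b∈ts : b ∈ ts) (x : ℕ) where

  private
    ltˡ : ∀ {t} → t ∈ ts → (t <ᵇ x) ≡ (rank ts t <ᵇ rank ts x)
    ltˡ t∈ts = rank-<ᵇ ts (inj₁ t∈ts)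
    ltʳ : ∀ {t} → t ∈ ts → (x <ᵇ t) ≡ (rank ts x <ᵇ rank ts t)
    ltʳ t∈ts = rank-<ᵇ ts (inj₂ t∈ts)

  inside-rank : inside a b x ≡ inside (rank ts a) (rank ts b) (rank ts x)
  inside-rank = cong₂ _∨_ (cong₂ _∧_ (ltˡ a∈ts) (ltʳ b∈ts)) (cong₂ _∧_ (ltˡ b∈ts) (ltʳ a∈ts))

  outside-rank : outside a b x ≡ outside (rank ts a) (rank ts b) (rank ts x)
  outside-rank = cong₂ _∨_ (cong₂ _∧_ (ltʳ a∈ts) (ltʳ b∈ts)) (cong₂ _∧_ (ltˡ a∈ts) (ltˡ b∈ts))

intertwined-rank : ∀ ts {a b} c d → a ∈ ts → b ∈ ts →
  intertwinedℕ a b c d ≡ intertwinedℕ (rank ts a) (rank ts b) (rank ts c) (rank ts d)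
intertwined-rank ts c d a∈ts b∈ts =
  cong₂ _∨_ (cong₂ _∧_ (inside-rank ts a∈ts b∈ts c) (outside-rank ts a∈ts b∈ts d))
            (cong₂ _∧_ (outside-rank ts a∈ts b∈ts c) (inside-rank ts a∈ts b∈ts d))

Ranked : List ℕ → ℕ → ℕ → Set
Ranked ts a a′ = a ∈ ts × rank ts a ≡ a′

module _ {ts : List ℕ} {a a′ : ℕ} where

  <ᵇ-rankedˡ : Ranked ts a a′ → ∀ x → (a <ᵇ x) ≡ (a′ <ᵇ rank ts x)
  <ᵇ-rankedˡ (a∈ts , ρa) x = trans (rank-<ᵇ ts (inj₁ a∈ts)) (cong (_<ᵇ rank ts x) ρa)

  <ᵇ-rankedʳ : Ranked ts a a′ → ∀ x → (x <ᵇ a) ≡ (rank ts x <ᵇ a′)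
  <ᵇ-rankedʳ (a∈ts , ρa) x = trans (rank-<ᵇ ts (inj₂ a∈ts)) (cong (rank ts x <ᵇ_) ρa)

  ≡ᵇ-ranked : Ranked ts a a′ → ∀ x → (x ≡ᵇ a) ≡ (rank ts x ≡ᵇ a′)
  ≡ᵇ-ranked (a∈ts , ρa) x = trans (rank-≡ᵇ ts (inj₂ a∈ts)) (cong (rank ts x ≡ᵇ_) ρa)

-- Four-point inequalities for crossings

crossing : ℕ → ℕ → ℕ → ℕ → ℕ
crossing a b c d = indicator (intertwinedℕ a b c d)

samePair : ℕ → ℕ → ℕ → ℕ → Bool
samePair c d p q = ((c ≡ᵇ p) ∧ (d ≡ᵇ q)) ∨ ((c ≡ᵇ q) ∧ (d ≡ᵇ p))

nestedBetween : ℕ → ℕ → ℕ → ℕ → ℕ → ℕ → Bool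
nestedBetween i u v j p q =
  not (p <ᵇ i) ∧ not (u <ᵇ p) ∧ not (q <ᵇ v) ∧ not (j <ᵇ q) ∧
  not ((p ≡ᵇ u) ∧ (q ≡ᵇ v)) ∧ not ((p ≡ᵇ i) ∧ (q ≡ᵇ j))

straddles : ℕ → ℕ → ℕ → ℕ → ℕ → Bool
straddles i y j p q = not (p <ᵇ i) ∧ (p <ᵇ y) ∧ (y <ᵇ q) ∧ not (j <ᵇ q) ∧ not ((p ≡ᵇ i) ∧ (q ≡ᵇ j))

private
  ≤-true⁻ : ∀ {m n} → not (n <ᵇ m) ≡ true → m ≤ n
  ≤-true⁻ n≮m = <ᵇ≡false⇒≥ (not-true⁻ n≮m)

  notBoth-true⁻ : ∀ {p q i j} → not ((p ≡ᵇ i) ∧ (q ≡ᵇ j)) ≡ true → ¬ (p ≡ i × q ≡ j)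
  notBoth-true⁻ {p} {q} ¬both (refl , refl) =
    subst (λ b → T (not b)) (cong₂ _∧_ (≡⇒≡ᵇ≡true {p} refl) (≡⇒≡ᵇ≡true {q} refl)) (≡true⇒T ¬both)

straddles-true⁻ : ∀ {i y j p q} → straddles i y j p q ≡ true →
  i ≤ p × p < y × y < q × q ≤ j × ¬ (p ≡ i × q ≡ j)
straddles-true⁻ s with ∧-true⁻ s
... | i≤p , s₁ with ∧-true⁻ s₁
... | p<y , s₂ with ∧-true⁻ s₂
... | y<q , s₃ with ∧-true⁻ s₃
... | q≤j , ¬ij = ≤-true⁻ i≤p , <ᵇ≡true⇒< p<y , <ᵇ≡true⇒< y<q , ≤-true⁻ q≤j , notBoth-true⁻ ¬ij

nestedBetween-true⁻ : ∀ {i u v j p q} → nestedBetween i u v j p q ≡ true →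
  i ≤ p × p ≤ u × v ≤ q × q ≤ j × ¬ (p ≡ u × q ≡ v) × ¬ (p ≡ i × q ≡ j)
nestedBetween-true⁻ s with ∧-true⁻ s
... | i≤p , s₁ with ∧-true⁻ s₁
... | p≤u , s₂ with ∧-true⁻ s₂
... | v≤q , s₃ with ∧-true⁻ s₃
... | q≤j , s₄ with ∧-true⁻ s₄
... | ¬uv , ¬ij =
  ≤-true⁻ i≤p , ≤-true⁻ p≤u , ≤-true⁻ v≤q , ≤-true⁻ q≤j , notBoth-true⁻ ¬uv , notBoth-true⁻ ¬ij

crossing-ranked : ∀ {ts a a′ b b′} → Ranked ts a a′ → Ranked ts b b′ → ∀ c d →
  crossing a b c d ≡ crossing a′ b′ (rank ts c) (rank ts d)
crossing-ranked {ts} (a∈ts , ρa) (b∈ts , ρb) c d =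
  cong indicator (trans (intertwined-rank ts c d a∈ts b∈ts)
                        (cong₂ (λ a′ b′ → intertwinedℕ a′ b′ (rank ts c) (rank ts d)) ρa ρb))

module _ {ts : List ℕ} where

  samePair-ranked : ∀ {p p′ q q′} → Ranked ts p p′ → Ranked ts q q′ → ∀ c d →
    samePair c d p q ≡ samePair (rank ts c) (rank ts d) p′ q′
  samePair-ranked rp rq c d =
    cong₂ _∨_ (cong₂ _∧_ (≡ᵇ-ranked rp c) (≡ᵇ-ranked rq d)) (cong₂ _∧_ (≡ᵇ-ranked rq c) (≡ᵇ-ranked rp d))

  nestedBetween-ranked : ∀ {i i′ u u′ v v′ j j′} →
    Ranked ts i i′ → Ranked ts u u′ → Ranked ts v v′ → Ranked ts j j′ → ∀ p q →
    nestedBetween i u v j p q ≡ nestedBetween i′ u′ v′ j′ (rank ts p) (rank ts q)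
  nestedBetween-ranked ri ru rv rj p q =
    cong₂ _∧_ (cong not (<ᵇ-rankedʳ ri p)) (cong₂ _∧_ (cong not (<ᵇ-rankedˡ ru p))
    (cong₂ _∧_ (cong not (<ᵇ-rankedʳ rv q)) (cong₂ _∧_ (cong not (<ᵇ-rankedˡ rj q))
    (cong₂ _∧_ (cong not (cong₂ _∧_ (≡ᵇ-ranked ru p) (≡ᵇ-ranked rv q)))
               (cong not (cong₂ _∧_ (≡ᵇ-ranked ri p) (≡ᵇ-ranked rj q)))))))

  straddles-ranked : ∀ {i i′ y y′ j j′} →
    Ranked ts i i′ → Ranked ts y y′ → Ranked ts j j′ → ∀ p q →
    straddles i y j p q ≡ straddles i′ y′ j′ (rank ts p) (rank ts q)
  straddles-ranked ri ry rj p q =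
    cong₂ _∧_ (cong not (<ᵇ-rankedʳ ri p)) (cong₂ _∧_ (<ᵇ-rankedʳ ry p)
    (cong₂ _∧_ (<ᵇ-rankedˡ ry q) (cong₂ _∧_ (cong not (<ᵇ-rankedˡ rj q))
               (cong not (cong₂ _∧_ (≡ᵇ-ranked ri p) (≡ᵇ-ranked rj q))))))

quadrangleRow : ℕ → ℕ → Bool
quadrangleRow c d =
  crossing 1 3 c d + crossing 5 7 c d + indicator (samePair c d 1 5) ≤ᵇ crossing 1 5 c d + crossing 3 7 c d

nestingRow : ℕ → ℕ → Bool
nestingRow c d = nestedBetween 1 3 5 7 c d ∨ nestedBetween 1 3 5 7 d c ∨
  (crossing 1 5 c d + crossing 3 7 c d ≤ᵇ crossing 3 5 c d + crossing 1 7 c d)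

splittingRow : ℕ → ℕ → Bool
splittingRow c d = straddles 1 3 5 c d ∨ straddles 1 3 5 d c ∨
  (crossing 1 3 c d + crossing 3 5 c d ≤ᵇ crossing 1 5 c d)

Table : ℕ → (ℕ → ℕ → Bool) → Set
Table m row = ∀ (c d : Fin m) → T (row (toℕ c) (toℕ d))

quadrangle-table : Table 9 quadrangleRow
quadrangle-table = toWitness {a? = all? λ c → all? λ d → T? (quadrangleRow (toℕ c) (toℕ d))} tt

nesting-table : Table 9 nestingRow
nesting-table = toWitness {a? = all? λ c → all? λ d → T? (nestingRow (toℕ c) (toℕ d))} tt

splitting-table : Table 7 splittingRow
splitting-table = toWitness {a? = all? λ c → all? λ d → T? (splittingRow (toℕ c) (toℕ d))} tt

lookupTable : ∀ {m} row → Table m row → ∀ {c d} → c < m → d < m → row c d ≡ true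
lookupTable row tab c<m d<m =
  T⇒≡true (subst₂ (λ c d → T (row c d)) (toℕ-fromℕ< c<m) (toℕ-fromℕ< d<m) (tab (fromℕ< c<m) (fromℕ< d<m)))

module FourPoints {p₀ p₁ p₂ p₃ : ℕ} (p₀<p₁ : p₀ < p₁) (p₁<p₂ : p₁ < p₂) (p₂<p₃ : p₂ < p₃) where

  private
    points : List ℕ
    points = p₀ ∷ p₁ ∷ p₂ ∷ p₃ ∷ []

    ρ : ℕ → ℕ
    ρ = rank points

    ρ<9 : ∀ x → ρ x < 9
    ρ<9 x = s≤s (rank-bound points x)

    p₀<p₂ : p₀ < p₂
    p₀<p₂ = <-trans p₀<p₁ p₁<p₂

    p₁<p₃ : p₁ < p₃
    p₁<p₃ = <-trans p₁<p₂ p₂<p₃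

    p₀<p₃ : p₀ < p₃
    p₀<p₃ = <-trans p₀<p₂ p₂<p₃

    r₀ : Ranked points p₀ 1
    r₀ = here refl , ρp₀
      where
      ρp₀ : ρ p₀ ≡ 1
      ρp₀ rewrite rankStep-≡ p₀ | rankStep-> p₀<p₁ | rankStep-> p₀<p₂ | rankStep-> p₀<p₃ = refl

    r₁ : Ranked points p₁ 3
    r₁ = there (here refl) , ρp₁
      where
      ρp₁ : ρ p₁ ≡ 3
      ρp₁ rewrite rankStep-< p₀<p₁ | rankStep-≡ p₁ | rankStep-> p₁<p₂ | rankStep-> p₁<p₃ = refl

    r₂ : Ranked points p₂ 5
    r₂ = there (there (here refl)) , ρp₂
      where
      ρp₂ : ρ p₂ ≡ 5
      ρp₂ rewrite rankStep-< p₀<p₂ | rankStep-< p₁<p₂ | rankStep-≡ p₂ | rankStep-> p₂<p₃ = refl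

    r₃ : Ranked points p₃ 7
    r₃ = there (there (there (here refl))) , ρp₃
      where
      ρp₃ : ρ p₃ ≡ 7
      ρp₃ rewrite rankStep-< p₀<p₃ | rankStep-< p₁<p₃ | rankStep-< p₂<p₃ | rankStep-≡ p₃ = refl

  quadrangle-crossings : ∀ c d →
    crossing p₀ p₁ c d + crossing p₂ p₃ c d + indicator (samePair c d p₀ p₂) ≤
    crossing p₀ p₂ c d + crossing p₁ p₃ c d
  quadrangle-crossings c d = begin
    crossing p₀ p₁ c d + crossing p₂ p₃ c d + indicator (samePair c d p₀ p₂)
      ≡⟨ cong₂ _+_ (cong₂ _+_ (crossing-ranked r₀ r₁ c d) (crossing-ranked r₂ r₃ c d))
                   (cong indicator (samePair-ranked r₀ r₂ c d)) ⟩
    crossing 1 3 (ρ c) (ρ d) + crossing 5 7 (ρ c) (ρ d) + indicator (samePair (ρ c) (ρ d) 1 5)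
      ≤⟨ ≤ᵇ≡true⇒≤ (lookupTable quadrangleRow quadrangle-table (ρ<9 c) (ρ<9 d)) ⟩
    crossing 1 5 (ρ c) (ρ d) + crossing 3 7 (ρ c) (ρ d)
      ≡⟨ cong₂ _+_ (crossing-ranked r₀ r₂ c d) (crossing-ranked r₁ r₃ c d) ⟨
    crossing p₀ p₂ c d + crossing p₁ p₃ c d ∎
    where open ≤-Reasoning

  nesting-crossings : ∀ c d →
    nestedBetween p₀ p₁ p₂ p₃ c d ≡ false → nestedBetween p₀ p₁ p₂ p₃ d c ≡ false →
    crossing p₀ p₂ c d + crossing p₁ p₃ c d ≤ crossing p₁ p₂ c d + crossing p₀ p₃ c d
  nesting-crossings c d ¬cd ¬dc = begin
    crossing p₀ p₂ c d + crossing p₁ p₃ c d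
      ≡⟨ cong₂ _+_ (crossing-ranked r₀ r₂ c d) (crossing-ranked r₁ r₃ c d) ⟩
    crossing 1 5 (ρ c) (ρ d) + crossing 3 7 (ρ c) (ρ d)
      ≤⟨ ≤ᵇ≡true⇒≤ (third-of-∨ (lookupTable nestingRow nesting-table (ρ<9 c) (ρ<9 d))
                                (trans (sym (nestedBetween-ranked r₀ r₁ r₂ r₃ c d)) ¬cd)
                                (trans (sym (nestedBetween-ranked r₀ r₁ r₂ r₃ d c)) ¬dc)) ⟩
    crossing 3 5 (ρ c) (ρ d) + crossing 1 7 (ρ c) (ρ d)
      ≡⟨ cong₂ _+_ (crossing-ranked r₁ r₂ c d) (crossing-ranked r₀ r₃ c d) ⟨
    crossing p₁ p₂ c d + crossing p₀ p₃ c d ∎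
    where open ≤-Reasoning

module ThreePoints {p₀ p₁ p₂ : ℕ} (p₀<p₁ : p₀ < p₁) (p₁<p₂ : p₁ < p₂) where

  private
    points : List ℕ
    points = p₀ ∷ p₁ ∷ p₂ ∷ []

    ρ : ℕ → ℕ
    ρ = rank points

    ρ<7 : ∀ x → ρ x < 7
    ρ<7 x = s≤s (rank-bound points x)

    p₀<p₂ : p₀ < p₂
    p₀<p₂ = <-trans p₀<p₁ p₁<p₂

    r₀ : Ranked points p₀ 1
    r₀ = here refl , ρp₀
      where
      ρp₀ : ρ p₀ ≡ 1
      ρp₀ rewrite rankStep-≡ p₀ | rankStep-> p₀<p₁ | rankStep-> p₀<p₂ = refl

    r₁ : Ranked points p₁ 3
    r₁ = there (here refl) , ρp₁
      where
      ρp₁ : ρ p₁ ≡ 3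
      ρp₁ rewrite rankStep-< p₀<p₁ | rankStep-≡ p₁ | rankStep-> p₁<p₂ = refl

    r₂ : Ranked points p₂ 5
    r₂ = there (there (here refl)) , ρp₂
      where
      ρp₂ : ρ p₂ ≡ 5
      ρp₂ rewrite rankStep-< p₀<p₂ | rankStep-< p₁<p₂ | rankStep-≡ p₂ = refl

  splitting-crossings : ∀ c d →
    straddles p₀ p₁ p₂ c d ≡ false → straddles p₀ p₁ p₂ d c ≡ false →
    crossing p₀ p₁ c d + crossing p₁ p₂ c d ≤ crossing p₀ p₂ c d
  splitting-crossings c d ¬cd ¬dc = begin
    crossing p₀ p₁ c d + crossing p₁ p₂ c d
      ≡⟨ cong₂ _+_ (crossing-ranked r₀ r₁ c d) (crossing-ranked r₁ r₂ c d) ⟩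
    crossing 1 3 (ρ c) (ρ d) + crossing 3 5 (ρ c) (ρ d)
      ≤⟨ ≤ᵇ≡true⇒≤ (third-of-∨ (lookupTable splittingRow splitting-table (ρ<7 c) (ρ<7 d))
                                (trans (sym (straddles-ranked r₀ r₁ r₂ c d)) ¬cd)
                                (trans (sym (straddles-ranked r₀ r₁ r₂ d c)) ¬dc)) ⟩
    crossing 1 5 (ρ c) (ρ d)
      ≡⟨ crossing-ranked r₀ r₂ c d ⟨
    crossing p₀ p₂ c d ∎
    where open ≤-Reasoning

-- Piercing numbers of position pairs

module Counting {n : ℕ} (G : Graph n) (π : Permutation′ n) where

  Σ² : (Fin n → Fin n → ℕ) → ℕ
  Σ² F = sum (map (λ x → sum (map (λ y → F x y) (allFin n))) (allFin n))

  Σ²-mono : ∀ {F H} → (∀ x y → F x y ≤ H x y) → Σ² F ≤ Σ² H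
  Σ²-mono F≤H = sum-map-mono (allFin n) λ x → sum-map-mono (allFin n) (F≤H x)

  Σ²-+ : ∀ F H → Σ² (λ x y → F x y + H x y) ≡ Σ² F + Σ² H
  Σ²-+ F H = trans (cong sum (map-cong (λ x → sum-map-+ (allFin n) (F x) (H x)) (allFin n)))
    (sum-map-+ (allFin n) (λ x → sum (map (F x) (allFin n))) (λ x → sum (map (H x) (allFin n))))

  Σ²-cong : ∀ {F H} → (∀ x y → F x y ≡ H x y) → Σ² F ≡ Σ² H
  Σ²-cong F≡H = cong sum (map-cong (λ x → cong sum (map-cong (F≡H x) (allFin n))) (allFin n))

  Σ²-≡0 : ∀ {F} → (∀ x y → F x y ≡ 0) → Σ² F ≡ 0
  Σ²-≡0 F≡0 = sum-map-≡0 (allFin n) λ x → sum-map-≡0 (allFin n) (F≡0 x)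

  ≤-Σ² : ∀ F x y → F x y ≤ Σ² F
  ≤-Σ² F x y = ≤-trans (≤-sum-map (F x) (∈-allFin y))
                       (≤-sum-map (λ x → sum (map (F x) (allFin n))) (∈-allFin x))

  position : Fin n → ℕ
  position x = toℕ (pos π x)

  edgeTerm : (ℕ → ℕ → Bool) → Fin n → Fin n → ℕ
  edgeTerm φ x y = indicator ((toℕ x <ᵇ toℕ y) ∧ (adj G x y ∧ φ (position x) (position y)))

  edgeCount : (ℕ → ℕ → Bool) → ℕ
  edgeCount φ = Σ² (edgeTerm φ)

  -- pierce (toℕ p) (toℕ q) is definitionally piercing G π p q.
  pierce : ℕ → ℕ → ℕ
  pierce a b = edgeCount (intertwinedℕ a b)

  chordMultiplicity : ℕ → ℕ → ℕ
  chordMultiplicity p q = edgeCount λ c d → samePair c d p q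

  Chord : ℕ → ℕ → Set
  Chord p q = Σ (Fin n) λ x → Σ (Fin n) λ y → position x ≡ p × position y ≡ q × adj G x y ≡ true

  edgeTerm-cases : ∀ x y →
    (∀ φ → edgeTerm φ x y ≡ 0) ⊎
    (adj G x y ≡ true × ∀ φ → edgeTerm φ x y ≡ indicator (φ (position x) (position y)))
  edgeTerm-cases x y with toℕ x <ᵇ toℕ y | adj G x y
  ... | false | _     = inj₁ λ φ → refl
  ... | true  | false = inj₁ λ φ → refl
  ... | true  | true  = inj₂ (refl , λ φ → refl)

  edgeCount-cong : ∀ {φ ψ} → (∀ x y → φ (position x) (position y) ≡ ψ (position x) (position y)) →
    edgeCount φ ≡ edgeCount ψ
  edgeCount-cong φ≡ψ = Σ²-cong λ x y → cong (λ b → indicator ((toℕ x <ᵇ toℕ y) ∧ (adj G x y ∧ b))) (φ≡ψ x y)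

  edgeCount-none : edgeCount (λ _ _ → false) ≡ 0
  edgeCount-none = Σ²-≡0 λ x y →
    cong indicator (trans (cong ((toℕ x <ᵇ toℕ y) ∧_) (∧-zeroʳ (adj G x y))) (∧-zeroʳ (toℕ x <ᵇ toℕ y)))

  pierce-sym : ∀ p q → pierce p q ≡ pierce q p
  pierce-sym p q = edgeCount-cong {intertwinedℕ p q} {intertwinedℕ q p} λ x y → intertwined-sym p q (position x) (position y)

  pierce-succ : ∀ p → pierce p (suc p) ≡ 0
  pierce-succ p =
    trans (edgeCount-cong {intertwinedℕ p (suc p)} λ x y → intertwined-succ p (position x) (position y))
          edgeCount-none

  pierce-full : ∀ m → n ≡ suc m → pierce 0 m ≡ 0
  pierce-full m n≡1+m =
    trans (edgeCount-cong {intertwinedℕ 0 m} λ x y → intertwined-nested z≤n (position≤m x) z≤n (position≤m y))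
          edgeCount-none
    where
    position≤m : ∀ x → position x ≤ m
    position≤m x = s≤s⁻¹ (subst (position x <_) n≡1+m (toℕ<n (pos π x)))

  chordMultiplicity-pos : ∀ {p q} → p ≢ q → Chord p q → 1 ≤ chordMultiplicity p q
  chordMultiplicity-pos {p} {q} p≢q (x , y , refl , refl , xy) with <-cmp (toℕ x) (toℕ y)
  ... | tri< x<y _ _ = ≤-trans (≤-reflexive (sym term≡1)) (≤-Σ² _ x y)
    where
    term≡1 : edgeTerm (λ c d → samePair c d p q) x y ≡ 1
    term≡1 rewrite <⇒<ᵇ≡true x<y | xy | ≡⇒≡ᵇ≡true {p} refl | ≡⇒≡ᵇ≡true {q} refl = refl
  ... | tri≈ _ x≡y _ = ⊥-elim (p≢q (cong position (toℕ-injective x≡y)))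
  ... | tri> _ _ y<x = ≤-trans (≤-reflexive (sym term≡1)) (≤-Σ² _ y x)
    where
    term≡1 : edgeTerm (λ c d → samePair c d p q) y x ≡ 1
    term≡1 rewrite <⇒<ᵇ≡true y<x | trans (Graph.sym G y x) xy | ≡⇒≡ᵇ≡true {q} refl | ≡⇒≡ᵇ≡true {p} refl
                 | ≢⇒≡ᵇ≡false (≢-sym p≢q) = refl

  quadrangle : ∀ {i s s′ j} → i < s → s < s′ → s′ < j →
    pierce i s + pierce s′ j + chordMultiplicity i s′ ≤ pierce i s′ + pierce s j
  quadrangle {i} {s} {s′} {j} i<s s<s′ s′<j =
    subst₂ _≤_ (trans (Σ²-+ (λ x y → left₁ x y + left₂ x y) left₃)
                      (cong (_+ chordMultiplicity i s′) (Σ²-+ left₁ left₂)))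
               (Σ²-+ right₁ right₂) (Σ²-mono term≤)
    where
    open FourPoints i<s s<s′ s′<j
    left₁ left₂ left₃ right₁ right₂ : Fin n → Fin n → ℕ
    left₁ = edgeTerm (intertwinedℕ i s)
    left₂ = edgeTerm (intertwinedℕ s′ j)
    left₃ = edgeTerm λ c d → samePair c d i s′
    right₁ = edgeTerm (intertwinedℕ i s′)
    right₂ = edgeTerm (intertwinedℕ s j)
    term≤ : ∀ x y → left₁ x y + left₂ x y + left₃ x y ≤ right₁ x y + right₂ x y
    term≤ x y with edgeTerm-cases x y
    ... | inj₁ vanishes
      rewrite vanishes (intertwinedℕ i s) | vanishes (intertwinedℕ s′ j) | vanishes (λ c d → samePair c d i s′) = z≤n
    ... | inj₂ (_ , crossings)
      rewrite crossings (intertwinedℕ i s) | crossings (intertwinedℕ s′ j) | crossings (λ c d → samePair c d i s′)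
            | crossings (intertwinedℕ i s′) | crossings (intertwinedℕ s j) =
      quadrangle-crossings (position x) (position y)

  nesting : ∀ {i u v j} → i < u → u < v → v < j →
    (∀ x y → adj G x y ≡ true → nestedBetween i u v j (position x) (position y) ≡ false) →
    pierce i v + pierce u j ≤ pierce u v + pierce i j
  nesting {i} {u} {v} {j} i<u u<v v<j unnested =
    subst₂ _≤_ (Σ²-+ left₁ left₂) (Σ²-+ right₁ right₂) (Σ²-mono term≤)
    where
    open FourPoints i<u u<v v<j
    left₁ left₂ right₁ right₂ : Fin n → Fin n → ℕ
    left₁ = edgeTerm (intertwinedℕ i v)
    left₂ = edgeTerm (intertwinedℕ u j)
    right₁ = edgeTerm (intertwinedℕ u v)
    right₂ = edgeTerm (intertwinedℕ i j)
    term≤ : ∀ x y → left₁ x y + left₂ x y ≤ right₁ x y + right₂ x y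
    term≤ x y with edgeTerm-cases x y
    ... | inj₁ vanishes rewrite vanishes (intertwinedℕ i v) | vanishes (intertwinedℕ u j) = z≤n
    ... | inj₂ (xy , crossings)
      rewrite crossings (intertwinedℕ i v) | crossings (intertwinedℕ u j)
            | crossings (intertwinedℕ u v) | crossings (intertwinedℕ i j) =
      nesting-crossings (position x) (position y) (unnested x y xy) (unnested y x (trans (Graph.sym G y x) xy))

  splitting : ∀ {i y j} → i < y → y < j →
    (∀ x z → adj G x z ≡ true → straddles i y j (position x) (position z) ≡ false) →
    pierce i y + pierce y j ≤ pierce i j
  splitting {i} {y} {j} i<y y<j unstraddled = subst (_≤ pierce i j) (Σ²-+ left₁ left₂) (Σ²-mono term≤)
    where
    open ThreePoints i<y y<j
    left₁ left₂ : Fin n → Fin n → ℕ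
    left₁ = edgeTerm (intertwinedℕ i y)
    left₂ = edgeTerm (intertwinedℕ y j)
    term≤ : ∀ x z → left₁ x z + left₂ x z ≤ edgeTerm (intertwinedℕ i j) x z
    term≤ x z with edgeTerm-cases x z
    ... | inj₁ vanishes rewrite vanishes (intertwinedℕ i y) | vanishes (intertwinedℕ y j) = z≤n
    ... | inj₂ (xz , crossings)
      rewrite crossings (intertwinedℕ i y) | crossings (intertwinedℕ y j) | crossings (intertwinedℕ i j) =
      splitting-crossings (position x) (position z) (unstraddled x z xz) (unstraddled z x (trans (Graph.sym G z x) xz))

-- Good apices

module BoundedSearch {P : ℕ → Set} (P? : Decidable P) where

  record Least (w : ℕ) : Set where
    field
      value   : ℕ
      holds   : P value
      ≤bound  : value ≤ w
      minimal : ∀ {m} → m < value → ¬ P m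

  record Greatest (w bound : ℕ) : Set where
    field
      value   : ℕ
      holds   : P value
      ≥start  : w ≤ value
      ≤bound  : value ≤ bound
      maximal : ∀ {m} → value < m → m ≤ bound → ¬ P m

  -- Opaque, so that type checking never unfolds a search.
  opaque

    ∃<? : ∀ bound → Dec (∃ λ m → m < bound × P m)
    ∃<? zero = no λ { (_ , () , _) }
    ∃<? (suc b) with P? b | ∃<? b
    ... | yes Pb | _                  = yes (b , ≤-refl , Pb)
    ... | no _   | yes (m , m<b , Pm) = yes (m , m<n⇒m<1+n m<b , Pm)
    ... | no ¬Pb | no none            = no λ (m , m<1+b , Pm) → excluded m<1+b Pm
      where
      excluded : ∀ {m} → m < suc b → P m → ⊥
      excluded {m} m<1+b Pm with m ≟ b
      ... | yes refl = ¬Pb Pm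
      ... | no m≢b   = none (m , ≤∧≢⇒< (s≤s⁻¹ m<1+b) m≢b , Pm)

    least : ∀ {w} → P w → Least w
    least {w} Pw = scan 0 w refl λ ()
      where
      scan : ∀ m gap → m + gap ≡ w → (∀ {m′} → m′ < m → ¬ P m′) → Least w
      scan m zero m+0≡w below = record
        { value = m ; holds = subst P (sym m≡w) Pw ; ≤bound = ≤-reflexive m≡w ; minimal = below }
        where
        m≡w : m ≡ w
        m≡w = trans (sym (+-identityʳ m)) m+0≡w
      scan m (suc gap) m+1+gap≡w below with P? m
      ... | yes Pm = record
        { value = m ; holds = Pm ; ≤bound = subst (m ≤_) m+1+gap≡w (m≤m+n m (suc gap)) ; minimal = below }
      ... | no ¬Pm = scan (suc m) gap (trans (sym (+-suc m gap)) m+1+gap≡w) below′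
        where
        below′ : ∀ {m′} → m′ < suc m → ¬ P m′
        below′ {m′} m′<1+m with m′ ≟ m
        ... | yes refl = ¬Pm
        ... | no m′≢m  = below (≤∧≢⇒< (s≤s⁻¹ m′<1+m) m′≢m)

    greatest : ∀ bound {w} → w ≤ bound → P w → Greatest w bound
    greatest zero z≤n Pw = record
      { value = 0 ; holds = Pw ; ≥start = z≤n ; ≤bound = z≤n ; maximal = λ 0<m m≤0 _ → <⇒≱ 0<m m≤0 }
    greatest (suc b) {w} w≤1+b Pw with P? (suc b)
    ... | yes P1+b = record
      { value = suc b ; holds = P1+b ; ≥start = w≤1+b ; ≤bound = ≤-refl
      ; maximal = λ 1+b<m m≤1+b _ → <⇒≱ 1+b<m m≤1+b }
    ... | no ¬P1+b = record
      { value = value ; holds = holds ; ≥start = ≥start ; ≤bound = m≤n⇒m≤1+n ≤bound ; maximal = maximal′ }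
      where
      open Greatest (greatest b (s≤s⁻¹ (≤∧≢⇒< w≤1+b λ w≡1+b → ¬P1+b (subst P w≡1+b Pw))) Pw)
      maximal′ : ∀ {m} → value < m → m ≤ suc b → ¬ P m
      maximal′ {m} value<m m≤1+b with m ≟ suc b
      ... | yes refl  = ¬P1+b
      ... | no m≢1+b = maximal value<m (s≤s⁻¹ (≤∧≢⇒< m≤1+b m≢1+b))

module Apex {n : ℕ} (G : Graph n) (π : Permutation′ n) {k : ℕ} (1≤k : 1 ≤ k)
            (kPlanar : OuterKPlanarDrawing k G π) where

  open Counting G π

  Chord? : ∀ p q → Dec (Chord p q)
  Chord? p q = any? λ x → any? λ y → (position x ≟ p) ×-dec (position y ≟ q) ×-dec (adj G x y ≟ᵇ true)

  Arc : ℕ → ℕ → Set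
  Arc p q = q ≡ suc p ⊎ Chord p q

  Arc? : ∀ p q → Dec (Arc p q)
  Arc? p q = (q ≟ suc p) ⊎-dec Chord? p q

  pierce-arc : ∀ {p q} → Arc p q → pierce p q ≤ k
  pierce-arc {p} (inj₁ refl)                   = subst (_≤ k) (sym (pierce-succ p)) z≤n
  pierce-arc (inj₂ (x , y , refl , refl , xy)) = kPlanar x y xy

  GoodApex : ℕ → ℕ → ℕ → Set
  GoodApex i j s = pierce i s ≤ k × pierce s j ≤ k × suc (pierce i s + pierce s j) ≤ 2 * k

  module _ {i j : ℕ} (i+2≤j : 2 + i ≤ j) (ij≤k : pierce i j ≤ k) where

    private
      a b : ℕ → ℕ
      a s = pierce i s
      b s = pierce s j

    GoodApex? : ∀ s → Dec (GoodApex i j s)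
    GoodApex? s = (a s ≤? k) ×-dec (b s ≤? k) ×-dec (suc (a s + b s) ≤? 2 * k)

    ArcIn : ℕ → ℕ → Set
    ArcIn p q = i ≤ p × p < q × q ≤ j × ¬ (p ≡ i × q ≡ j) × Arc p q

    ArcIn? : ∀ p q → Dec (ArcIn p q)
    ArcIn? p q = (i ≤? p) ×-dec (p <? q) ×-dec (q ≤? j) ×-dec ¬? ((p ≟ i) ×-dec (q ≟ j)) ×-dec Arc? p q

    pierce-arcIn : ∀ {p q} → ArcIn p q → pierce p q ≤ k
    pierce-arcIn (_ , _ , _ , _ , pq) = pierce-arc pq

    Maximal : ℕ → ℕ → Set
    Maximal p q = ∀ {p′ q′} → ArcIn p′ q′ → p′ ≤ p → q ≤ q′ → p′ ≡ p × q′ ≡ q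

    -- The state of the search for an apex when none exists.
    record Invariant (x y : ℕ) : Set where
      field
        arc     : ArcIn x y
        y<j     : y < j
        maximal : Maximal x y
        tight   : x ≡ i ⊎ a y < k

    module NoGoodApex (noApex : ∀ {s} → i < s → s < j → ¬ GoodApex i j s) where

      private
        2*k≡k+k : 2 * k ≡ k + k
        2*k≡k+k = cong (k +_) (+-identityʳ k)

      a≤k⇒k≤b : ∀ {s} → i < s → s < j → a s ≤ k → k ≤ b s
      a≤k⇒k≤b {s} i<s s<j as≤k = ≮⇒≥ λ bs<k →
        noApex i<s s<j (as≤k , <⇒≤ bs<k , subst (suc (a s + b s) ≤_) (sym 2*k≡k+k) (+-mono-≤-< as≤k bs<k))

      a<k⇒k<b : ∀ {s} → i < s → s < j → a s < k → k < b s
      a<k⇒k<b {s} i<s s<j as<k = ≰⇒> λ bs≤k →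
        noApex i<s s<j (<⇒≤ as<k , bs≤k , subst (suc (a s + b s) ≤_) (sym 2*k≡k+k) (+-mono-<-≤ as<k bs≤k))

      a<b⇒k<b : ∀ {s} → i < s → s < j → a s < b s → k < b s
      a<b⇒k<b {s} i<s s<j as<bs =
        [ (λ bs≤k → a<k⇒k<b i<s s<j (<-≤-trans as<bs bs≤k)) , (λ k<bs → k<bs) ]′ (≤-<-connex (b s) k)

      module Step {x y : ℕ} (inv : Invariant x y) where

        open Invariant inv

        i≤x : i ≤ x
        i≤x = proj₁ arc

        x<y : x < y
        x<y = proj₁ (proj₂ arc)

        i<y : i < y
        i<y = ≤-<-trans i≤x x<y

        ay≤k : a y ≤ k
        ay≤k = [ (λ x≡i → subst (λ x → pierce x y ≤ k) x≡i (pierce-arcIn arc)) , <⇒≤ ]′ tight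

        k≤by : k ≤ b y
        k≤by = a≤k⇒k≤b i<y y<j ay≤k

        noArcAround : ∀ {p q} → ArcIn p q → p ≤ x → y < q → ⊥
        noArcAround pq p≤x y<q = <⇒≢ y<q (sym (proj₂ (maximal pq p≤x (<⇒≤ y<q))))

        Beyond : ℕ → ℕ → Set
        Beyond p q = y < q × ArcIn p q

        Candidate : ℕ → Set
        Candidate p = x < p × p ≤ y × ∃ λ q → q < suc j × Beyond p q

        candidate : ∀ {p q} → ArcIn p q → x < p → p ≤ y → y < q → Candidate p
        candidate pq x<p p≤y y<q = x<p , p≤y , _ , s≤s (proj₁ (proj₂ (proj₂ pq))) , y<q , pq

        Candidate? : Decidable Candidate
        Candidate? p = (x <? p) ×-dec (p ≤? y) ×-dec BoundedSearch.∃<? (λ q → (y <? q) ×-dec ArcIn? p q) (suc j)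

        candidate-y : Candidate y
        candidate-y =
          candidate (≤-trans i≤x (<⇒≤ x<y) , ≤-refl , y<j , (λ (y≡i , _) → <⇒≢ i<y (sym y≡i)) , inj₁ refl)
                    x<y ≤-refl ≤-refl

        open BoundedSearch.Least (BoundedSearch.least Candidate? candidate-y)
          renaming (value to u; holds to candidate-u; ≤bound to u≤y; minimal to u-least)

        x<u : x < u
        x<u = proj₁ candidate-u

        firstEnd : ∃ λ q → q < suc j × Beyond u q
        firstEnd = proj₂ (proj₂ candidate-u)

        Beyond? : Decidable (Beyond u)
        Beyond? q = (y <? q) ×-dec ArcIn? u q

        open BoundedSearch.Greatest
               (BoundedSearch.greatest Beyond? j (s≤s⁻¹ (proj₁ (proj₂ firstEnd))) (proj₂ (proj₂ firstEnd)))
          renaming (value to v; holds to beyond-uv; ≤bound to v≤j; maximal to v-greatest)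

        y<v : y < v
        y<v = proj₁ beyond-uv

        arc-uv : ArcIn u v
        arc-uv = proj₂ beyond-uv

        u<v : u < v
        u<v = ≤-<-trans u≤y y<v

        i<u : i < u
        i<u = ≤-<-trans i≤x x<u

        maximal-uv : Maximal u v
        maximal-uv {p} {q} pq p≤u v≤q =
          [ (λ p≤x → ⊥-elim (noArcAround pq p≤x y<q)) , (λ x<p → p≡u x<p , q≡v x<p) ]′ (≤-<-connex p x)
          where
          y<q : y < q
          y<q = <-≤-trans y<v v≤q
          p≡u : x < p → p ≡ u
          p≡u x<p = ≤-antisym p≤u (≮⇒≥ λ p<u → u-least p<u (candidate pq x<p (≤-trans p≤u u≤y) y<q))
          q≡v : x < p → q ≡ v
          q≡v x<p = ≤-antisym (≮⇒≥ λ v<q → v-greatest v<q (proj₁ (proj₂ (proj₂ pq)))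
                                                       (y<q , subst (λ p → ArcIn p q) (p≡u x<p) pq)) v≤q

        unstraddled : u ≡ y → ∀ x′ z′ → adj G x′ z′ ≡ true →
                      straddles i y j (position x′) (position z′) ≡ false
        unstraddled u≡y x′ z′ xz = ¬-not λ straddle →
          let i≤p , p<y , y<q , q≤j , ¬ij = straddles-true⁻ straddle
          in over (i≤p , <-trans p<y y<q , q≤j , ¬ij , inj₂ (x′ , z′ , refl , refl , xz)) p<y y<q
          where
          over : ∀ {p q} → ArcIn p q → p < y → y < q → ⊥
          over {p} pq p<y y<q =
            [ (λ p≤x → noArcAround pq p≤x y<q)
            , (λ x<p → u-least (subst (p <_) (sym u≡y) p<y) (candidate pq x<p (<⇒≤ p<y) y<q)) ]′ (≤-<-connex p x)

        -- If nothing straddles y then a y + b y ≤ pierce i j ≤ k, which leaves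
        -- no room for a y = k ≤ b y.
        k<by : u ≡ y → k < b y
        k<by u≡y =
          [ a<k⇒k<b i<y y<j
          , (λ k≤ay → ⊥-elim (<⇒≱ 1≤k (≤-trans k≤by (+-cancelˡ-≤ k (b y) 0 (k+by≤k+0 k≤ay))))) ]′
          (<-≤-connex (a y) k)
          where
          k+by≤k+0 : k ≤ a y → k + b y ≤ k + 0
          k+by≤k+0 k≤ay = begin
            k + b y    ≡⟨ cong (_+ b y) (≤-antisym ay≤k k≤ay) ⟨
            a y + b y  ≤⟨ splitting i<y y<j (unstraddled u≡y) ⟩
            pierce i j ≤⟨ ij≤k ⟩
            k          ≡⟨ +-identityʳ k ⟨
            k + 0      ∎
            where open ≤-Reasoning

        chord-xy : u < y → Chord x y
        chord-xy u<y = [ (λ y≡1+x → ⊥-elim (<⇒≱ x<u (s≤s⁻¹ (subst (u <_) y≡1+x u<y)))) , (λ xy → xy) ]′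
                         (proj₂ (proj₂ (proj₂ (proj₂ arc))))

        ay<by+chords : u < y → a y < b y + chordMultiplicity i y
        ay<by+chords u<y =
          [ (λ x≡i → ≤-<-trans (≤-trans ay≤k k≤by)
                       (m<m+n (b y) (chordMultiplicity-pos (<⇒≢ i<y) (subst (λ x → Chord x y) x≡i (chord-xy u<y)))))
          , (λ ay<k → <-≤-trans (<-trans ay<k (a<k⇒k<b i<y y<j ay<k)) (m≤m+n (b y) _)) ]′ tight

        k<bu : k < b u
        k<bu = [ (λ u<y → a<b⇒k<b i<u (<-trans u<y y<j) (cancel-quadrangle (quadrangle i<u u<y y<j) (ay<by+chords u<y)))
               , (λ u≡y → subst (λ s → k < b s) (sym u≡y) (k<by u≡y)) ]′ (m≤n⇒m<n∨m≡n u≤y)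

        v<j : v < j
        v<j = ≤∧≢⇒< v≤j λ v≡j → <⇒≱ k<bu (subst (λ v → pierce u v ≤ k) v≡j (pierce-arcIn arc-uv))

        unnested : ∀ x′ z′ → adj G x′ z′ ≡ true → nestedBetween i u v j (position x′) (position z′) ≡ false
        unnested x′ z′ xz = ¬-not λ nested →
          let i≤p , p≤u , v≤q , q≤j , ¬uv , ¬ij = nestedBetween-true⁻ nested
              arc-pq : ArcIn (position x′) (position z′)
              arc-pq = i≤p , <-≤-trans (≤-<-trans p≤u u<v) v≤q , q≤j , ¬ij , inj₂ (x′ , z′ , refl , refl , xz)
          in ¬uv (maximal-uv arc-pq p≤u v≤q)

        av<k : a v < k
        av<k = +-cancelʳ-< (b u) (a v) k (begin-strict
          a v + b u               ≤⟨ nesting i<u u<v v<j unnested ⟩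
          pierce u v + pierce i j ≤⟨ +-mono-≤ (pierce-arcIn arc-uv) ij≤k ⟩
          k + k                   <⟨ +-monoʳ-< k k<bu ⟩
          k + b u                 ∎)
          where open ≤-Reasoning

        step : ∃₂ λ u v → Invariant u v × y < v
        step = u , v , record { arc = arc-uv ; y<j = v<j ; maximal = maximal-uv ; tight = inj₂ av<k } , y<v

      initial : ∃ λ y → Invariant i y
      initial = y , record { arc = arc-iy ; y<j = y<j ; maximal = maximal-iy ; tight = inj₁ refl }
        where
        i+1<j : suc i < j
        i+1<j = i+2≤j
        End? : Decidable λ q → q < j × ArcIn i q
        End? q = (q <? j) ×-dec ArcIn? i q
        open BoundedSearch.Greatest (BoundedSearch.greatest End? j (<⇒≤ i+1<j)
               (i+1<j , ≤-refl , ≤-refl , <⇒≤ i+1<j , (λ (_ , i+1≡j) → <⇒≢ i+1<j i+1≡j) , inj₁ refl))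
          renaming (value to y; maximal to y-greatest)
        y<j : y < j
        y<j = proj₁ holds
        arc-iy : ArcIn i y
        arc-iy = proj₂ holds
        maximal-iy : Maximal i y
        maximal-iy {p} {q} pq p≤i y≤q =
          p≡i , ≤-antisym (≮⇒≥ λ y<q → y-greatest y<q q≤j (q<j , subst (λ p → ArcIn p q) p≡i pq)) y≤q
          where
          p≡i : p ≡ i
          p≡i = ≤-antisym p≤i (proj₁ pq)
          q≤j : q ≤ j
          q≤j = proj₁ (proj₂ (proj₂ pq))
          q<j : q < j
          q<j = ≤∧≢⇒< q≤j λ q≡j → proj₁ (proj₂ (proj₂ (proj₂ pq))) (p≡i , q≡j)

      -- The right end of the invariant arc strictly increases but stays below j.
      exhausted : ∀ fuel {x y} → j ∸ y ≤ fuel → Invariant x y → ⊥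
      exhausted zero       j∸y≤0 inv = <⇒≱ (Invariant.y<j inv) (m∸n≡0⇒m≤n (n≤0⇒n≡0 j∸y≤0))
      exhausted (suc fuel) j∸y≤1+fuel inv =
        let u , v , inv′ , y<v = Step.step inv
        in exhausted fuel (s≤s⁻¹ (<-≤-trans (∸-monoʳ-< y<v (<⇒≤ (Invariant.y<j inv′))) j∸y≤1+fuel)) inv′

      impossible : ⊥
      impossible = exhausted j (m∸n≤m j (proj₁ initial)) (proj₂ initial)

    goodApex : ∃ λ s → i < s × s < j × GoodApex i j s
    goodApex with BoundedSearch.∃<? (λ s → (i <? s) ×-dec GoodApex? s) j
    ... | yes (s , s<j , i<s , good) = s , i<s , s<j , good
    ... | no none = ⊥-elim (NoGoodApex.impossible λ i<s s<j good → none (_ , s<j , i<s , good))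

-- Triangulating by good apices

module Construction {n : ℕ} (G : Graph n) (π : Permutation′ n) {k : ℕ} (1≤k : 1 ≤ k)
                    (kPlanar : OuterKPlanarDrawing k G π) where

  open Counting G π
  open Apex G π 1≤k kPlanar using (GoodApex; goodApex)

  Link : Set
  Link = Fin n × Fin n

  first second : Link → ℕ
  first l  = toℕ (proj₁ l)
  second l = toℕ (proj₂ l)

  -- Inner links of a triangulation of the polygon i, i + 1, …, j with base (i, j).
  InnerLinkIn : ℕ → ℕ → Link → Set
  InnerLinkIn i j l =
    i ≤ first l × second l ≤ j × 2 + first l ≤ second l × (i < first l ⊎ second l < j) ×
    pierce (first l) (second l) ≤ k

  LinkIn : ℕ → ℕ → List Link → Fin n → Fin n → Set
  LinkIn i j L a b =
    (toℕ a ≡ i × toℕ b ≡ j) ⊎ (a , b) ∈ L ⊎ (toℕ b ≡ suc (toℕ a) × i ≤ toℕ a × toℕ b ≤ j)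

  TrianglesAtMost : ℕ → ℕ → List Link → ℕ → Set
  TrianglesAtMost i j L m = ∀ a b c → toℕ a < toℕ b → toℕ b < toℕ c →
    LinkIn i j L a b → LinkIn i j L b c → LinkIn i j L a c →
    pierce (toℕ a) (toℕ b) + pierce (toℕ b) (toℕ c) + pierce (toℕ a) (toℕ c) ≤ m

  record Triangulated (i j : ℕ) : Set where
    field
      links       : List Link
      count       : length links ≡ (j ∸ i) ∸ 2
      linksInner  : All (InnerLinkIn i j) links
      linksApart  : AllPairs NonIntertwinedDistinct links
      triangles   : TrianglesAtMost i j links (3 * k ∸ 1)

  linkIn-bounds : ∀ {i j L a b} → All (InnerLinkIn i j) L → LinkIn i j L a b → i ≤ toℕ a × toℕ b ≤ j
  linkIn-bounds _        (inj₁ (refl , refl))          = ≤-refl , ≤-refl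
  linkIn-bounds allInner (inj₂ (inj₁ ab∈L))            = let i≤a , b≤j , _ = All.lookup allInner ab∈L in i≤a , b≤j
  linkIn-bounds _        (inj₂ (inj₂ (_ , i≤a , b≤j))) = i≤a , b≤j

  edge-triangulated : ∀ {i j} → i < j → ¬ (2 + i ≤ j) → Triangulated i j
  edge-triangulated {i} {j} i<j i+2≰j = record
    { links = [] ; count = sym (cong (_∸ 2) (trans (cong (_∸ i) j≡1+i) (m+n∸n≡m 1 i)))
    ; linksInner = [] ; linksApart = [] ; triangles = noTriangle }
    where
    j≡1+i : j ≡ suc i
    j≡1+i = ≤-antisym (≮⇒≥ i+2≰j) i<j
    noTriangle : TrianglesAtMost i j [] (3 * k ∸ 1)
    noTriangle a b c a<b b<c ab bc _ = ⊥-elim (i+2≰j (begin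
      2 + i       ≤⟨ s≤s (s≤s (proj₁ (linkIn-bounds [] ab))) ⟩
      2 + toℕ a   ≤⟨ s≤s a<b ⟩
      suc (toℕ b) ≤⟨ b<c ⟩
      toℕ c       ≤⟨ proj₂ (linkIn-bounds [] bc) ⟩
      j           ∎))
      where open ≤-Reasoning

  Within : ℕ → ℕ → Link → Set
  Within lo hi l = lo ≤ first l × second l ≤ hi × first l < second l

  within-inner : ∀ {lo hi l} → InnerLinkIn lo hi l → Within lo hi l
  within-inner (lo≤ , ≤hi , 2+first≤second , _) = lo≤ , ≤hi , ≤-trans (n≤1+n _) 2+first≤second

  apart : ∀ {lo mid hi l l′} → Within lo mid l → Within mid hi l′ → NonIntertwinedDistinct l l′
  apart (_ , second≤mid , first<second) (mid≤first′ , _ , first′<second′) =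
    (λ { refl → <⇒≱ first<second (≤-trans second≤mid mid≤first′) }) ,
    intertwined-disjoint first<second (≤-trans second≤mid mid≤first′)
                         (≤-trans second≤mid (≤-trans mid≤first′ (<⇒≤ first′<second′)))

  apart-all : ∀ {lo mid hi L L′} → All (Within lo mid) L → All (Within mid hi) L′ →
    All (λ l → All (NonIntertwinedDistinct l) L′) L
  apart-all ws ws′ = All.map (λ w → All.map (apart w) ws′) ws

  module Closure {i s : ℕ} (i<s : i < s) (s<n : s < n) (T : Triangulated i s) where

    open Triangulated T

    base : Link
    base = fromℕ< (<-trans i<s s<n) , fromℕ< s<n

    first-base : first base ≡ i
    first-base = toℕ-fromℕ< (<-trans i<s s<n)

    second-base : second base ≡ s
    second-base = toℕ-fromℕ< s<n

    close : Dec (2 + i ≤ s) → List Link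
    close (yes _) = base ∷ links
    close (no _)  = links

    closure : List Link
    closure = close (2 + i ≤? s)

    length-closure : length closure ≡ (s ∸ i) ∸ 1
    length-closure = length-close (2 + i ≤? s)
      where
      length-close : ∀ d → length (close d) ≡ (s ∸ i) ∸ 1
      length-close (yes i+2≤s) =
        trans (cong suc count) (suc[m∸2]≡m∸1 (subst (_≤ s ∸ i) (m+n∸n≡m 2 i) (∸-monoˡ-≤ i i+2≤s)))
      length-close (no i+2≰s) = trans count (trans (cong (_∸ 2) s∸i≡1) (sym (cong (_∸ 1) s∸i≡1)))
        where
        s∸i≡1 : s ∸ i ≡ 1
        s∸i≡1 = trans (cong (_∸ i) (≤-antisym (≮⇒≥ i+2≰s) i<s)) (m+n∸n≡m 1 i)

    within-closure : All (Within i s) closure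
    within-closure = within-close (2 + i ≤? s)
      where
      within-close : ∀ d → All (Within i s) (close d)
      within-close (yes _) =
        (≤-reflexive (sym first-base) , ≤-reflexive second-base , subst₂ _<_ (sym first-base) (sym second-base) i<s)
        ∷ All.map within-inner linksInner
      within-close (no _)  = All.map within-inner linksInner

    inner-closure : ∀ {lo hi} → lo ≤ i → s ≤ hi → lo < i ⊎ s < hi → pierce i s ≤ k →
                    All (InnerLinkIn lo hi) closure
    inner-closure {lo} {hi} lo≤i s≤hi proper is≤k = inner-close (2 + i ≤? s)
      where
      widen : ∀ {l} → InnerLinkIn i s l → InnerLinkIn lo hi l
      widen (i≤first , second≤s , 2+first≤second , _ , pierce≤k) =
        ≤-trans lo≤i i≤first , ≤-trans second≤s s≤hi , 2+first≤second ,
        [ (λ lo<i → inj₁ (<-≤-trans lo<i i≤first)) , (λ s<hi → inj₂ (≤-<-trans second≤s s<hi)) ]′ proper ,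
        pierce≤k
      inner-close : ∀ d → All (InnerLinkIn lo hi) (close d)
      inner-close (yes i+2≤s) =
        (subst (lo ≤_) (sym first-base) lo≤i , subst (_≤ hi) (sym second-base) s≤hi ,
         subst₂ (λ i s → 2 + i ≤ s) (sym first-base) (sym second-base) i+2≤s ,
         subst₂ (λ i s → lo < i ⊎ s < hi) (sym first-base) (sym second-base) proper ,
         subst₂ (λ i s → pierce i s ≤ k) (sym first-base) (sym second-base) is≤k)
        ∷ All.map widen linksInner
      inner-close (no _) = All.map widen linksInner

    nonCrossing-closure : AllPairs NonIntertwinedDistinct closure
    nonCrossing-closure = nonCrossing-close (2 + i ≤? s)
      where
      base-apart : ∀ {l} → InnerLinkIn i s l → NonIntertwinedDistinct base l
      base-apart {l} (i≤first , second≤s , 2+first≤second , proper , _) =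
        (λ { refl → [ (λ i<first → <⇒≢ i<first (sym first-base)) , (λ second<s → <⇒≢ second<s second-base) ]′
                    proper }) ,
        trans (cong₂ (λ i s → intertwinedℕ i s (first l) (second l)) first-base second-base)
              (intertwined-nested i≤first (≤-trans (≤-trans (m≤n+m _ 2) 2+first≤second) second≤s)
                                  (≤-trans i≤first (≤-trans (m≤n+m _ 2) 2+first≤second)) second≤s)
      nonCrossing-close : ∀ d → AllPairs NonIntertwinedDistinct (close d)
      nonCrossing-close (yes _) = All.map base-apart linksInner ∷ linksApart
      nonCrossing-close (no _)  = linksApart

    linkIn-closure : ∀ {a b} → (a , b) ∈ closure → LinkIn i s links a b
    linkIn-closure = linkIn-close (2 + i ≤? s)
      where
      linkIn-close : ∀ d {a b} → (a , b) ∈ close d → LinkIn i s links a b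
      linkIn-close (yes _) (here refl)  = inj₁ (first-base , second-base)
      linkIn-close (yes _) (there ab∈L) = inj₂ (inj₁ ab∈L)
      linkIn-close (no _)  ab∈L         = inj₂ (inj₁ ab∈L)

  module Glue {i s j : ℕ} (i<s : i < s) (s<j : s < j) (j<n : j < n) (ij≤k : pierce i j ≤ k)
              (apex : GoodApex i j s) (T₁ : Triangulated i s) (T₂ : Triangulated s j) where

    private
      module T₁ = Triangulated T₁
      module T₂ = Triangulated T₂
      module C₁ = Closure i<s (<-trans s<j j<n) T₁
      module C₂ = Closure s<j j<n T₂

    links : List Link
    links = C₁.closure ++ C₂.closure

    count : length links ≡ (j ∸ i) ∸ 2
    count = begin
      length (C₁.closure ++ C₂.closure)                  ≡⟨ length-++ C₁.closure ⟩
      length C₁.closure + length C₂.closure              ≡⟨ cong₂ _+_ C₁.length-closure C₂.length-closure ⟩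
      (s ∸ i) ∸ 1 + ((j ∸ s) ∸ 1)                        ≡⟨ pred+pred (∸-positive i<s) (∸-positive s<j) ⟩
      ((s ∸ i) + (j ∸ s)) ∸ 2                            ≡⟨ cong (_∸ 2) (∸-split (<⇒≤ i<s) (<⇒≤ s<j)) ⟨
      (j ∸ i) ∸ 2                                        ∎
      where open ≡-Reasoning

    Split : Fin n → Fin n → Set
    Split a b = (toℕ a ≡ i × toℕ b ≡ j) ⊎ LinkIn i s T₁.links a b ⊎ LinkIn s j T₂.links a b

    split : ∀ {a b} → LinkIn i j links a b → Split a b
    split (inj₁ base) = inj₁ base
    split (inj₂ (inj₁ ab∈links)) =
      [ (λ ab∈C₁ → inj₂ (inj₁ (C₁.linkIn-closure ab∈C₁)))
      , (λ ab∈C₂ → inj₂ (inj₂ (C₂.linkIn-closure ab∈C₂))) ]′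
      (∈-++⁻ C₁.closure ab∈links)
    split {a} {b} (inj₂ (inj₂ (b≡1+a , i≤a , b≤j))) =
      [ (λ b≤s → inj₂ (inj₁ (inj₂ (inj₂ (b≡1+a , i≤a , b≤s)))))
      , (λ s<b → inj₂ (inj₂ (inj₂ (inj₂ (b≡1+a , s≤s⁻¹ (subst (s <_) b≡1+a s<b) , b≤j))))) ]′
      (≤-<-connex (toℕ b) s)

    bounds₁ : ∀ {a b} → LinkIn i s T₁.links a b → i ≤ toℕ a × toℕ b ≤ s
    bounds₁ = linkIn-bounds T₁.linksInner

    bounds₂ : ∀ {a b} → LinkIn s j T₂.links a b → s ≤ toℕ a × toℕ b ≤ j
    bounds₂ = linkIn-bounds T₂.linksInner

    left : ∀ {a b} → toℕ a < toℕ b → toℕ b ≤ s → Split a b → LinkIn i s T₁.links a b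
    left a<b b≤s (inj₁ (_ , b≡j))   = ⊥-elim (<⇒≱ s<j (subst (_≤ s) b≡j b≤s))
    left a<b b≤s (inj₂ (inj₁ ab))   = ab
    left a<b b≤s (inj₂ (inj₂ ab))   = ⊥-elim (<⇒≱ a<b (≤-trans b≤s (proj₁ (bounds₂ ab))))

    right : ∀ {a b} → toℕ a < toℕ b → s ≤ toℕ a → Split a b → LinkIn s j T₂.links a b
    right a<b s≤a (inj₁ (a≡i , _))  = ⊥-elim (<⇒≱ i<s (subst (s ≤_) a≡i s≤a))
    right a<b s≤a (inj₂ (inj₁ ab))  = ⊥-elim (<⇒≱ a<b (≤-trans (proj₂ (bounds₁ ab)) s≤a))
    right a<b s≤a (inj₂ (inj₂ ab))  = ab

    -- A triangle reaching across s can only be the apex triangle (i, s, j).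
    across-base : ∀ {a c} → toℕ a < s → s < toℕ c → Split a c → toℕ a ≡ i × toℕ c ≡ j
    across-base a<s s<c (inj₁ base)       = base
    across-base a<s s<c (inj₂ (inj₁ ac₁)) = ⊥-elim (<⇒≱ s<c (proj₂ (bounds₁ ac₁)))
    across-base a<s s<c (inj₂ (inj₂ ac₂)) = ⊥-elim (<⇒≱ a<s (proj₁ (bounds₂ ac₂)))

    ≤apex : ∀ {a b} → toℕ a < s → toℕ b < j → Split a b → toℕ b ≤ s
    ≤apex a<s b<j (inj₁ (_ , b≡j))  = ⊥-elim (<-irrefl b≡j b<j)
    ≤apex a<s b<j (inj₂ (inj₁ ab₁)) = proj₂ (bounds₁ ab₁)
    ≤apex a<s b<j (inj₂ (inj₂ ab₂)) = ⊥-elim (<⇒≱ a<s (proj₁ (bounds₂ ab₂)))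

    apex≤ : ∀ {b c} → i < toℕ b → s < toℕ c → Split b c → s ≤ toℕ b
    apex≤ i<b s<c (inj₁ (b≡i , _))  = ⊥-elim (<-irrefl (sym b≡i) i<b)
    apex≤ i<b s<c (inj₂ (inj₁ bc₁)) = ⊥-elim (<⇒≱ s<c (proj₂ (bounds₁ bc₁)))
    apex≤ i<b s<c (inj₂ (inj₂ bc₂)) = proj₁ (bounds₂ bc₂)

    apexTriangle : ∀ {a b c} → toℕ a < toℕ b → toℕ b < toℕ c → toℕ a < s → s < toℕ c →
      Split a b → Split b c → Split a c → toℕ a ≡ i × toℕ b ≡ s × toℕ c ≡ j
    apexTriangle a<b b<c a<s s<c ab bc ac with across-base a<s s<c ac
    ... | a≡i , c≡j =
      a≡i , ≤-antisym (≤apex a<s (subst (_ <_) c≡j b<c) ab) (apex≤ (subst (_< _) a≡i a<b) s<c bc) , c≡j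

    triangles : TrianglesAtMost i j links (3 * k ∸ 1)
    triangles a b c a<b b<c ab bc ac
      with split ab | split bc | split ac | ≤-<-connex (toℕ c) s | ≤-<-connex s (toℕ a)
    ... | ab′ | bc′ | ac′ | inj₁ c≤s | _ =
      T₁.triangles a b c a<b b<c (left a<b (<⇒≤ (<-≤-trans b<c c≤s)) ab′) (left b<c c≤s bc′)
                                  (left (<-trans a<b b<c) c≤s ac′)
    ... | ab′ | bc′ | ac′ | inj₂ _ | inj₁ s≤a =
      T₂.triangles a b c a<b b<c (right a<b s≤a ab′) (right b<c (≤-trans s≤a (<⇒≤ a<b)) bc′)
                                  (right (<-trans a<b b<c) s≤a ac′)
    ... | ab′ | bc′ | ac′ | inj₂ s<c | inj₂ a<s
      with apexTriangle a<b b<c a<s s<c ab′ bc′ ac′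
    ...   | a≡i , b≡s , c≡j rewrite a≡i | b≡s | c≡j =
      triangle-bound {k} {pierce i s} {pierce s j} (proj₂ (proj₂ apex)) ij≤k

    glued : Triangulated i j
    glued = record
      { links = links ; count = count
      ; linksInner = All.++⁺ (C₁.inner-closure ≤-refl (<⇒≤ s<j) (inj₂ s<j) (proj₁ apex))
                             (C₂.inner-closure (<⇒≤ i<s) ≤-refl (inj₁ i<s) (proj₁ (proj₂ apex)))
      ; linksApart = AllPairs.++⁺ C₁.nonCrossing-closure C₂.nonCrossing-closure
                                  (apart-all C₁.within-closure C₂.within-closure)
      ; triangles = triangles }

  triangulate : ∀ fuel {i j} → j ∸ i ≤ fuel → i < j → j < n → pierce i j ≤ k → Triangulated i j
  triangulate zero j∸i≤0 i<j _ _ = ⊥-elim (<⇒≱ i<j (m∸n≡0⇒m≤n (n≤0⇒n≡0 j∸i≤0)))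
  triangulate (suc fuel) {i} {j} j∸i≤1+fuel i<j j<n ij≤k with 2 + i ≤? j
  ... | no  i+2≰j = edge-triangulated i<j i+2≰j
  ... | yes i+2≤j =
    let s , i<s , s<j , apex = goodApex i+2≤j ij≤k
    in Glue.glued i<s s<j j<n ij≤k apex
         (triangulate fuel (s≤s⁻¹ (<-≤-trans (∸-monoˡ-< s<j (<⇒≤ i<s)) j∸i≤1+fuel))
                      i<s (<-trans s<j j<n) (proj₁ apex))
         (triangulate fuel (s≤s⁻¹ (<-≤-trans (∸-monoʳ-< i<s (<⇒≤ s<j)) j∸i≤1+fuel))
                      s<j j<n (proj₁ (proj₂ apex)))

module Polygon {n : ℕ} (3≤n : 3 ≤ n) (G : Graph n) (π : Permutation′ n) {k : ℕ} (1≤k : 1 ≤ k)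
               (kPlanar : OuterKPlanarDrawing k G π) where

  open Counting G π
  open Construction G π 1≤k kPlanar

  last : ℕ
  last = n ∸ 1

  n≡1+last : n ≡ suc last
  n≡1+last = sym (m+[n∸m]≡n (≤-trans (s≤s z≤n) 3≤n))

  ≤last : ∀ (p : Fin n) → toℕ p ≤ last
  ≤last p = s≤s⁻¹ (subst (toℕ p <_) n≡1+last (toℕ<n p))

  polygon : Triangulated 0 last
  polygon = triangulate last ≤-refl (≤-trans (s≤s z≤n) (∸-monoˡ-≤ 1 3≤n)) (subst (last <_) (sym n≡1+last) ≤-refl)
                        (subst (_≤ k) (sym (pierce-full last n≡1+last)) z≤n)

  open Triangulated polygon

  innerLinkOK : ∀ {l} → InnerLinkIn 0 last l → InnerLinkOK l
  innerLinkOK {l} (_ , _ , 2+first≤second , proper , _) = ≤-trans (n≤1+n _) 2+first≤second , notOuter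
    where
    notOuter : ¬ OuterLink (proj₁ l) (proj₂ l)
    notOuter (inj₁ second≡1+first)        = <-irrefl (sym second≡1+first) 2+first≤second
    notOuter (inj₂ (inj₁ first≡1+second)) =
      <⇒≱ 2+first≤second (≤-trans (n≤1+n _) (≤-trans (n≤1+n _) (≤-reflexive (cong suc (sym first≡1+second)))))
    notOuter (inj₂ (inj₂ (inj₁ (first≡0 , 1+second≡n)))) =
      [ (λ 0<first → <⇒≢ 0<first (sym first≡0))
      , (λ second<last → <⇒≢ (s≤s second<last) (trans 1+second≡n n≡1+last)) ]′
      proper
    notOuter (inj₂ (inj₂ (inj₂ (second≡0 , _)))) = <⇒≱ 2+first≤second (subst (_≤ suc (first l)) (sym second≡0) z≤n)

  triangulation : Triangulation n
  triangulation = record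
    { inner = links ; innerCount = trans count (∸-+-assoc n 1 2)
    ; innerOK = All.map innerLinkOK linksInner ; nonCrossing = linksApart }

  outer-pierce≡0 : ∀ {p q} → OuterLink p q → pierce (toℕ p) (toℕ q) ≡ 0
  outer-pierce≡0 {p} (inj₁ q≡1+p) = trans (cong (pierce (toℕ p)) q≡1+p) (pierce-succ (toℕ p))
  outer-pierce≡0 {q = q} (inj₂ (inj₁ p≡1+q)) =
    trans (cong (λ p → pierce p (toℕ q)) p≡1+q) (trans (pierce-sym (suc (toℕ q)) (toℕ q)) (pierce-succ (toℕ q)))
  outer-pierce≡0 (inj₂ (inj₂ (inj₁ (p≡0 , 1+q≡n)))) =
    trans (cong₂ pierce p≡0 (suc-injective (trans 1+q≡n n≡1+last))) (pierce-full last n≡1+last)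
  outer-pierce≡0 (inj₂ (inj₂ (inj₂ (q≡0 , 1+p≡n)))) =
    trans (cong₂ pierce (suc-injective (trans 1+p≡n n≡1+last)) q≡0)
          (trans (pierce-sym last 0) (pierce-full last n≡1+last))

  edgePiercing : EdgePiercingAtMost G π triangulation k
  edgePiercing p q (inj₁ outer)         = subst (_≤ k) (sym (outer-pierce≡0 outer)) z≤n
  edgePiercing p q (inj₂ (inj₁ pq∈L))   = proj₂ (proj₂ (proj₂ (proj₂ (All.lookup linksInner pq∈L))))
  edgePiercing p q (inj₂ (inj₂ qp∈L))   =
    subst (_≤ k) (pierce-sym (toℕ q) (toℕ p)) (proj₂ (proj₂ (proj₂ (proj₂ (All.lookup linksInner qp∈L)))))

  linkIn-polygon : ∀ {a b} → toℕ a < toℕ b → IsLink triangulation a b → LinkIn 0 last links a b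
  linkIn-polygon {a} {b} a<b (inj₁ (inj₁ b≡1+a))  = inj₂ (inj₂ (b≡1+a , z≤n , ≤last b))
  linkIn-polygon a<b (inj₁ (inj₂ (inj₁ a≡1+b)))   = ⊥-elim (<⇒≱ a<b (≤-trans (n≤1+n _) (≤-reflexive (sym a≡1+b))))
  linkIn-polygon a<b (inj₁ (inj₂ (inj₂ (inj₁ (a≡0 , 1+b≡n))))) = inj₁ (a≡0 , suc-injective (trans 1+b≡n n≡1+last))
  linkIn-polygon {a} a<b (inj₁ (inj₂ (inj₂ (inj₂ (b≡0 , _))))) =
    ⊥-elim (<⇒≱ a<b (subst (_≤ toℕ a) (sym b≡0) z≤n))
  linkIn-polygon a<b (inj₂ (inj₁ ab∈L)) = inj₂ (inj₁ ab∈L)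
  linkIn-polygon a<b (inj₂ (inj₂ ba∈L)) =
    ⊥-elim (<⇒≱ a<b (≤-trans (n≤1+n _) (≤-trans (n≤1+n _) (proj₁ (proj₂ (proj₂ (All.lookup linksInner ba∈L)))))))

  trianglePiercing : TrianglePiercingAtMost G π triangulation (3 * k ∸ 1)
  trianglePiercing a b c a<b b<c ab bc ac =
    triangles a b c a<b b<c (linkIn-polygon a<b ab) (linkIn-polygon b<c bc) (linkIn-polygon (<-trans a<b b<c) ac)

lemma7 : (k : ℕ) → (∃ λ m → k ≡ 1 + 2 * m) →
         (n : ℕ) → 3 ≤ n → (G : Graph n) → MaximalOuterKPlanar k G →
         (π : Permutation′ n) → OuterKPlanarDrawing k G π →
         Σ (Triangulation n) λ T →
           EdgePiercingAtMost G π T k × TrianglePiercingAtMost G π T (3 * k ∸ 1)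
lemma7 k (m , k≡1+2m) n 3≤n G _ π kPlanar = triangulation , edgePiercing , trianglePiercing
  where
  open Polygon 3≤n G π (subst (1 ≤_) (sym k≡1+2m) (s≤s z≤n)) kPlanar
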